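{- Let $t$ be a positive integer and let $H$ be a graph with vertex sets $A,B,X\subseteq V(H)$. If $H$ contains $2t$ pairwise disjoint $A$–$X$ paths $Q_1,\dots,Q_{2t}$ and $t$ pairwise disjoint $B$–$X$ paths $R_1,\dots,R_t$, then $H$ contains $2t$ pairwise disjoint paths $P_1,\dots,P_{2t}$ such that $P_i$ is an $A$–$X$ path for $i\in[t]$ and a $B$–$X$ path for $i\in[2t]\setminus[t]$. Moreover, $\{P_1,\dots,P_t\}\subseteq\{Q_1,\dots,Q_{2t}\}$ and $P_i\subseteq\bigcup_{j\in[2t]}Q_j\cup\bigcup_{j\in[t]}R_j$ for all $i\in[2t]$.
   Context: For vertex sets $Y,Z$, a $Y$–$Z$ path is a path whose first vertex is its only vertex in $Y$ and whose last vertex is its only vertex in $Z$. $[n]=\{1,\dots,n\}$. -}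

module Defs where

open import Level using (0ℓ)
open import Data.Nat using (ℕ)
open import Data.Fin using (Fin)
open import Data.Fin.Subset using (Subset) renaming (_∈_ to _∈ₛ_)
open import Data.List using (List; []; _∷_; _++_; _∷ʳ_)
open import Data.List.Membership.Propositional using (_∈_)
open import Data.List.Relation.Unary.Unique.Propositional using (Unique)
open import Data.List.Relation.Unary.Linked using (Linked)
open import Data.Product using (Σ; ∃; ∃₂; _×_)
open import Data.Sum using (_⊎_)
open import Data.Empty using (⊥)
open import Relation.Binary.PropositionalEquality using (_≡_; _≢_)

record Graph (n : ℕ) : Set₁ where
  field
    _~_    : Fin n → Fin n → Set
    ~-sym  : ∀ {u v} → u ~ v → v ~ u
    ~-irr  : ∀ {u} → u ~ u → ⊥
open Graph public

record IsPath {n : ℕ} (G : Graph n) (p : List (Fin n)) : Set where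
  field
    nonempty : p ≢ []
    distinct : Unique p
    adjacent : Linked (_~_ G) p

record IsPathBetween {n : ℕ} (G : Graph n) (Y Z : Subset n) (p : List (Fin n)) : Set where
  field
    isPath  : IsPath G p
    first   : ∃₂ λ v vs → p ≡ v ∷ vs × v ∈ₛ Y × (∀ u → u ∈ p → u ∈ₛ Y → u ≡ v)
    last    : ∃₂ λ ws w → p ≡ ws ∷ʳ w × w ∈ₛ Z × (∀ u → u ∈ p → u ∈ₛ Z → u ≡ w)

Disjoint : {n : ℕ} → List (Fin n) → List (Fin n) → Set
Disjoint p q = ∀ v → v ∈ p → v ∈ q → ⊥

PairwiseDisjoint : {n k : ℕ} → (Fin k → List (Fin n)) → Set
PairwiseDisjoint {k = k} f = (i j : Fin k) → i ≢ j → Disjoint (f i) (f j)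

EdgeOf : {n : ℕ} → List (Fin n) → Fin n → Fin n → Set
EdgeOf p u v = ∃₂ λ xs ys → p ≡ xs ++ (u ∷ v ∷ ys)

HasEdge : {n : ℕ} → List (Fin n) → Fin n → Fin n → Set
HasEdge p u v = EdgeOf p u v ⊎ EdgeOf p v u

-- P ⊆ ⋃_j Q_j ∪ ⋃_j R_j as subgraphs: every vertex and every edge of P lies in
-- some Q_j or some R_j.
SubgraphOfUnion : {n k l : ℕ} → List (Fin n) → (Fin k → List (Fin n)) → (Fin l → List (Fin n)) → Set
SubgraphOfUnion {k = k} {l = l} p Q R =
  (∀ v → v ∈ p → (∃ λ (j : Fin k) → v ∈ Q j) ⊎ (∃ λ (j : Fin l) → v ∈ R j)) ×
  (∀ u v → EdgeOf p u v → (∃ λ (j : Fin k) → HasEdge (Q j) u v) ⊎ (∃ λ (j : Fin l) → HasEdge (R j) u v))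

-- Keep t disjoint B–X paths R′ inside ⋃Q ∪ ⋃R, starting from R. If some Qₖ meets R′ and the last
-- vertex c of Qₖ on R′ lies on R′ᵢ but is not its end, reroute R′ᵢ: follow it up to c, then follow
-- Qₖ to its end, and cut the result at its last vertex in B. This lowers the number of steps of R′
-- that are not steps of some Qⱼ, so the process stops. Then every Qₖ avoids R′ or contains an end
-- of R′; as the Qₖ are disjoint, at most t of them contain an end, and t of the 2t paths Qₖ avoid R′.
module Submission where

open import Defs
open import Data.Nat using (ℕ; _*_; _<_; _≥_)
open import Data.Fin using (Fin; toℕ)
open import Data.Fin.Subset using (Subset)
open import Data.List using (List)
open import Data.Product using (Σ; ∃; _×_)
open import Relation.Binary.PropositionalEquality using (_≡_)

open import Data.Bool using (if_then_else_)
open import Data.Empty using (⊥; ⊥-elim)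
open import Data.Fin using (zero; suc; punchIn; punchOut; cast; splitAt; lift)
open import Data.Fin.Properties
  using ( _≟_; any?; suc-injective; punchInᵢ≢i; punchIn-punchOut; lift-injective; cast-involutive
        ; splitAt⁻¹-↑ˡ; splitAt⁻¹-↑ʳ)
open import Data.Fin.Subset using () renaming (_∈_ to _∈ₛ_)
open import Data.Fin.Subset.Properties using () renaming (_∈?_ to _∈ₛ?_)
open import Data.List using ([]; _∷_; _++_; _∷ʳ_; [_])
open import Data.List.Properties using (++-assoc; ∷-injectiveʳ; ++-conicalʳ)
open import Data.List.Membership.Propositional using (_∈_; _∉_; lose)
open import Data.List.Membership.Propositional.Properties using (∈-++⁺ˡ; ∈-++⁺ʳ; ∈-++⁻; ∈-∃++)
open import Data.List.Relation.Unary.All as All using (All; []; _∷_)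
import Data.List.Relation.Unary.All.Properties as All
open import Data.List.Relation.Unary.Any as Any using (Any; here; there)
open import Data.List.Relation.Unary.AllPairs using ([]; _∷_)
open import Data.List.Relation.Unary.Linked using (Linked; []; [-]; _∷_)
open import Data.List.Relation.Unary.Unique.Propositional using (Unique)
import Data.List.Relation.Unary.Unique.Propositional.Properties as Unique
open import Data.Nat using (zero; suc; _+_; _≤_; s≤s⁻¹)
open import Data.Nat.Induction using (<-wellFounded)
open import Data.Nat.Properties
  using ( +-identityʳ; +-assoc; +-suc; m≤n+m; ≤-refl; ≤-trans; ≤-reflexive; +-monoˡ-<; +-monoʳ-<
        ; n≢0⇒n>0; m+n≡0⇒m≡0; m+n≡0⇒n≡0; +-0-commutativeMonoid; module ≤-Reasoning)
open import Algebra.Properties.CommutativeMonoid.Sum +-0-commutativeMonoid using (sum; sum-remove; sum-cong-≗)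
open import Data.Product using (_,_; proj₁; proj₂; ∃₂)
open import Data.Sum using (_⊎_; inj₁; inj₂; [_,_]′)
open import Data.Vec.Functional using (Vector) renaming (_++_ to _++ᵛ_)
open import Data.Vec.Functional.Properties using (lookup-++-<; lookup-++-≥)
open import Function using (_∘_; id; case_of_)
open import Function.Definitions using (Injective)
open import Induction.WellFounded using (Acc; acc)
open import Relation.Binary.PropositionalEquality using (_≢_; refl; sym; trans; cong; subst)
open import Relation.Nullary using (¬_; Dec; yes; no; does)
open import Relation.Unary using (Decidable)
open import Relation.Binary.Definitions using (DecidableEquality)

module _ {A : Set} where

  data Consecutive : List A → A → A → Set where
    now   : ∀ {u v r} → Consecutive (u ∷ v ∷ r) u v
    later : ∀ {x r u v} → Consecutive r u v → Consecutive (x ∷ r) u v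

  Consecutive⇒∈ : ∀ {p u v} → Consecutive p u v → u ∈ p × v ∈ p
  Consecutive⇒∈ now = here refl , there (here refl)
  Consecutive⇒∈ (later uv) = there (proj₁ (Consecutive⇒∈ uv)) , there (proj₂ (Consecutive⇒∈ uv))

  Consecutive⇒split : ∀ {p u v} → Consecutive p u v → ∃₂ λ xs ys → p ≡ xs ++ u ∷ v ∷ ys
  Consecutive⇒split (now {r = r}) = [] , r , refl
  Consecutive⇒split (later {x = x} uv) with xs , ys , refl ← Consecutive⇒split uv = x ∷ xs , ys , refl

  split⇒Consecutive : ∀ {p u v} → (∃₂ λ xs ys → p ≡ xs ++ u ∷ v ∷ ys) → Consecutive p u v
  split⇒Consecutive ([] , _ , refl) = now
  split⇒Consecutive (x ∷ xs , ys , refl) = later (split⇒Consecutive (xs , ys , refl))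

  Consecutive? : DecidableEquality A → ∀ p u v → Dec (Consecutive p u v)
  Consecutive? _≟ᴬ_ [] u v = no λ ()
  Consecutive? _≟ᴬ_ (x ∷ []) u v = no λ { (later ()) }
  Consecutive? _≟ᴬ_ (x ∷ y ∷ r) u v with Consecutive? _≟ᴬ_ (y ∷ r) u v | x ≟ᴬ u | y ≟ᴬ v
  ... | yes uv | _ | _ = yes (later uv)
  ... | no _ | yes refl | yes refl = yes now
  ... | no ¬uv | no x≢u | _ = no λ { now → x≢u refl ; (later uv) → ¬uv uv }
  ... | no ¬uv | yes _ | no y≢v = no λ { now → y≢v refl ; (later uv) → ¬uv uv }

  Consecutive-++⁺ʳ : ∀ (zs : List A) {l u v} → Consecutive l u v → Consecutive (zs ++ l) u v
  Consecutive-++⁺ʳ [] uv = uv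
  Consecutive-++⁺ʳ (z ∷ zs) uv = later (Consecutive-++⁺ʳ zs uv)

  Consecutive-join⁺ˡ : ∀ (xs : List A) {c ys u v} → Consecutive (xs ∷ʳ c) u v → Consecutive (xs ++ c ∷ ys) u v
  Consecutive-join⁺ˡ [] (later ())
  Consecutive-join⁺ˡ (x ∷ []) now = now
  Consecutive-join⁺ˡ (x ∷ []) (later (later ()))
  Consecutive-join⁺ˡ (x ∷ y ∷ xs) now = now
  Consecutive-join⁺ˡ (x ∷ y ∷ xs) (later uv) = later (Consecutive-join⁺ˡ (y ∷ xs) uv)

  Consecutive-join⁻ : ∀ (xs : List A) {c ys u v} → Consecutive (xs ++ c ∷ ys) u v →
                      Consecutive (xs ∷ʳ c) u v ⊎ Consecutive (c ∷ ys) u v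
  Consecutive-join⁻ [] uv = inj₂ uv
  Consecutive-join⁻ (x ∷ []) now = inj₁ now
  Consecutive-join⁻ (x ∷ []) (later uv) = inj₂ uv
  Consecutive-join⁻ (x ∷ y ∷ xs) now = inj₁ now
  Consecutive-join⁻ (x ∷ y ∷ xs) (later uv) with Consecutive-join⁻ (y ∷ xs) uv
  ... | inj₁ uv′ = inj₁ (later uv′)
  ... | inj₂ uv′ = inj₂ uv′

  Consecutive⇒Linked : ∀ {R : A → A → Set} (p : List A) → (∀ {u v} → Consecutive p u v → R u v) → Linked R p
  Consecutive⇒Linked [] _ = []
  Consecutive⇒Linked (x ∷ []) _ = [-]
  Consecutive⇒Linked (x ∷ y ∷ p) f = f now ∷ Consecutive⇒Linked (y ∷ p) (f ∘ later)

  Linked-propagate : ∀ {R : A → A → Set} {P : A → Set} → (∀ {u v} → R u v → P u → P v) →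
                     ∀ {x xs} → P x → Linked R (x ∷ xs) → All P (x ∷ xs)
  Linked-propagate step Px [-] = Px ∷ []
  Linked-propagate step Px (xy ∷ l) = Px ∷ Linked-propagate step (step xy Px) l

  Linked-join : ∀ {R : A → A → Set} (xs : List A) {c ys} →
                Linked R (xs ∷ʳ c) → Linked R (c ∷ ys) → Linked R (xs ++ c ∷ ys)
  Linked-join [] _ l = l
  Linked-join (x ∷ []) (xc ∷ _) l = xc ∷ l
  Linked-join (x ∷ y ∷ xs) (xy ∷ l′) l = xy ∷ Linked-join (y ∷ xs) l′ l

  Linked-join⁻ˡ : ∀ {R : A → A → Set} (xs : List A) {c ys} → Linked R (xs ++ c ∷ ys) → Linked R (xs ∷ʳ c)
  Linked-join⁻ˡ [] _ = [-]
  Linked-join⁻ˡ (x ∷ []) (xc ∷ _) = xc ∷ [-]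
  Linked-join⁻ˡ (x ∷ y ∷ xs) (xy ∷ l) = xy ∷ Linked-join⁻ˡ (y ∷ xs) l

  Linked-++⁻ʳ : ∀ {R : A → A → Set} (zs : List A) {l} → Linked R (zs ++ l) → Linked R l
  Linked-++⁻ʳ [] l = l
  Linked-++⁻ʳ (z ∷ []) [-] = []
  Linked-++⁻ʳ (z ∷ []) (_ ∷ l) = l
  Linked-++⁻ʳ (z ∷ z′ ∷ zs) (_ ∷ l) = Linked-++⁻ʳ (z′ ∷ zs) l

  Unique-++⁻ˡ : ∀ (xs : List A) {ys} → Unique (xs ++ ys) → Unique xs
  Unique-++⁻ˡ [] _ = []
  Unique-++⁻ˡ (x ∷ xs) (x∉ ∷ u) = All.++⁻ˡ xs x∉ ∷ Unique-++⁻ˡ xs u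

  Unique-++⁻ʳ : ∀ (xs : List A) {ys} → Unique (xs ++ ys) → Unique ys
  Unique-++⁻ʳ [] u = u
  Unique-++⁻ʳ (x ∷ xs) (_ ∷ u) = Unique-++⁻ʳ xs u

  Unique-++⇒disjoint : ∀ (xs : List A) {ys} → Unique (xs ++ ys) → ∀ v → v ∈ xs → v ∈ ys → ⊥
  Unique-++⇒disjoint (x ∷ xs) (x∉ ∷ _) v (here refl) v∈ys = All.lookup (All.++⁻ʳ xs x∉) v∈ys refl
  Unique-++⇒disjoint (x ∷ xs) (_ ∷ u) v (there v∈xs) v∈ys = Unique-++⇒disjoint xs u v v∈xs v∈ys

  ∷ʳ-suffix : ∀ (zs : List A) {y ys ws w} → zs ++ y ∷ ys ≡ ws ∷ʳ w → ∃ λ ws′ → y ∷ ys ≡ ws′ ∷ʳ w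
  ∷ʳ-suffix [] eq = _ , eq
  ∷ʳ-suffix (z ∷ []) {ws = []} ()
  ∷ʳ-suffix (z ∷ _ ∷ _) {ws = []} ()
  ∷ʳ-suffix (z ∷ zs) {ws = _ ∷ _} eq = ∷ʳ-suffix zs (∷-injectiveʳ eq)

  ∈-rejoin : ∀ (xs : List A) {c ys zs v vs} → xs ++ c ∷ ys ≡ v ∷ vs → v ∈ xs ++ c ∷ zs
  ∈-rejoin [] refl = here refl
  ∈-rejoin (x ∷ xs) refl = here refl

  record LastOccurrence (P : A → Set) (xs : List A) : Set where
    field
      before   : List A
      pivot    : A
      after    : List A
      split    : xs ≡ before ++ pivot ∷ after
      pivot-P  : P pivot
      after-¬P : All (¬_ ∘ P) after

  lastOccurrence : ∀ {P : A → Set} → Decidable P → ∀ {xs} → Any P xs → LastOccurrence P xs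
  lastOccurrence P? {x ∷ xs} p with Any.any? P? xs
  ... | yes ps = record { before = x ∷ before ; pivot = pivot ; after = after
                        ; split = cong (x ∷_) split ; pivot-P = pivot-P ; after-¬P = after-¬P }
    where open LastOccurrence (lastOccurrence P? ps)
  ... | no ¬ps = record
    { before = [] ; pivot = x ; after = xs ; split = refl
    ; pivot-P = [ id , ⊥-elim ∘ ¬ps ]′ (Any.toSum p) ; after-¬P = All.¬Any⇒All¬ xs ¬ps }

module _ {A : Set} {E : A → A → Set} (E? : ∀ u v → Dec (E u v)) where

  defects : List A → ℕ
  defects (x ∷ y ∷ r) = (if does (E? x y) then 0 else 1) + defects (y ∷ r)
  defects _ = 0

  defects-join : ∀ (xs : List A) {c ys} → defects (xs ++ c ∷ ys) ≡ defects (xs ∷ʳ c) + defects (c ∷ ys)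
  defects-join [] = refl
  defects-join (x ∷ []) {c} {ys} = cong (_+ defects (c ∷ ys)) (sym (+-identityʳ _))
  defects-join (x ∷ y ∷ xs) {c} {ys} =
    trans (cong (_ +_) (defects-join (y ∷ xs))) (sym (+-assoc (if does (E? x y) then 0 else 1) _ _))

  defects-++-≤ : ∀ (zs : List A) {l} → defects l ≤ defects (zs ++ l)
  defects-++-≤ [] = ≤-refl
  defects-++-≤ (z ∷ []) {[]} = ≤-refl
  defects-++-≤ (z ∷ []) {y ∷ l} = m≤n+m _ _
  defects-++-≤ (z ∷ z′ ∷ zs) {l} = ≤-trans (defects-++-≤ (z′ ∷ zs)) (m≤n+m _ _)

  Linked⇒defects≡0 : ∀ {l} → Linked E l → defects l ≡ 0
  Linked⇒defects≡0 [] = refl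
  Linked⇒defects≡0 [-] = refl
  Linked⇒defects≡0 {x ∷ y ∷ _} (xy ∷ l) with E? x y
  ... | yes _ = Linked⇒defects≡0 l
  ... | no ¬xy = ⊥-elim (¬xy xy)

  defects≡0⇒Linked : ∀ l → defects l ≡ 0 → Linked E l
  defects≡0⇒Linked [] _ = []
  defects≡0⇒Linked (x ∷ []) _ = [-]
  defects≡0⇒Linked (x ∷ y ∷ r) eq =
    step≡0⇒E (m+n≡0⇒m≡0 _ eq) ∷ defects≡0⇒Linked (y ∷ r) (m+n≡0⇒n≡0 (if does (E? x y) then 0 else 1) eq)
    where
    step≡0⇒E : (if does (E? x y) then 0 else 1) ≡ 0 → E x y
    step≡0⇒E eq with E? x y
    ... | yes xy = xy

sum-<-at : ∀ {k} (f g : Vector ℕ k) (i : Fin k) → (∀ j → j ≢ i → f j ≡ g j) → f i < g i → sum f < sum g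
sum-<-at {suc k} f g i f≗g fi<gi = begin-strict
  sum f                     ≡⟨ sum-remove {i = i} f ⟩
  f i + sum (f ∘ punchIn i) ≡⟨ cong (f i +_) (sum-cong-≗ (λ j → f≗g (punchIn i j) (punchInᵢ≢i i j))) ⟩
  f i + sum (g ∘ punchIn i) <⟨ +-monoˡ-< _ fi<gi ⟩
  g i + sum (g ∘ punchIn i) ≡⟨ sum-remove {i = i} g ⟨
  sum g                     ∎
  where open ≤-Reasoning

all⊎any : ∀ {k} {P Q : Fin k → Set} → (∀ j → P j ⊎ Q j) → (∀ j → P j) ⊎ ∃ Q
all⊎any {zero} _ = inj₁ λ ()
all⊎any {suc k} P⊎Q with P⊎Q zero | all⊎any (P⊎Q ∘ suc)
... | inj₂ q | _ = inj₂ (zero , q)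
... | inj₁ _ | inj₂ (j , q) = inj₂ (suc j , q)
... | inj₁ p | inj₁ ps = inj₁ λ { zero → p ; (suc j) → ps j }

unblocked-injection : ∀ {m s u} (Blocks : Fin s → Fin m → Set) → (∀ i k → Dec (Blocks i k)) →
  (∀ {i k k′} → Blocks i k → Blocks i k′ → k ≡ k′) → u + s ≤ m →
  Σ (Fin u → Fin m) λ σ → Injective _≡_ _≡_ σ × (∀ a i → ¬ Blocks i (σ a))
unblocked-injection {zero} {u = zero} _ _ _ _ = (λ ()) , (λ { {()} }) , (λ ())
unblocked-injection {suc m} {s} {u} Blocks Blocks? functional u+s≤m with any? (λ i → Blocks? i zero)
unblocked-injection {suc m} {suc s} {u} Blocks Blocks? functional u+s≤m | yes (i , i⊳0)
  with σ , σ-inj , unblocked ←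
    unblocked-injection (λ j k → Blocks (punchIn i j) (suc k)) (λ j k → Blocks? _ _)
      (λ b b′ → suc-injective (functional b b′)) (s≤s⁻¹ (subst (_≤ suc m) (+-suc u s) u+s≤m))
  = suc ∘ σ , σ-inj ∘ suc-injective , avoids
  where
  avoids : ∀ a i′ → ¬ Blocks i′ (suc (σ a))
  avoids a i′ b with i ≟ i′
  ... | yes refl with () ← functional i⊳0 b
  ... | no i≢i′ =
    unblocked a (punchOut i≢i′) (subst (λ j → Blocks j (suc (σ a))) (sym (punchIn-punchOut i≢i′)) b)
unblocked-injection {suc m} {u = zero} _ _ _ _ | no _ = (λ ()) , (λ { {()} }) , (λ ())
unblocked-injection {suc m} {u = suc u} Blocks Blocks? functional u+s≤m | no none
  with σ , σ-inj , unblocked ←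
    unblocked-injection (λ i k → Blocks i (suc k)) (λ i k → Blocks? _ _)
      (λ b b′ → suc-injective (functional b b′)) (s≤s⁻¹ u+s≤m)
  = lift 1 σ , lift-injective σ σ-inj 1 , avoids
  where
  avoids : ∀ a i → ¬ Blocks i (lift 1 σ a)
  avoids zero i b = none (i , b)
  avoids (suc a) i b = unblocked a i b

cast-injective : ∀ {k l} .(eq : k ≡ l) → Injective _≡_ _≡_ (cast eq)
cast-injective eq {a} {b} ca≡cb =
  trans (sym (cast-involutive (sym eq) eq a)) (trans (cong (cast _) ca≡cb) (cast-involutive (sym eq) eq b))

module _ {n : ℕ} where

  Disjoint-sym : ∀ {p q : List (Fin n)} → Disjoint p q → Disjoint q p
  Disjoint-sym p∩q v v∈q v∈p = p∩q v v∈p v∈q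

  PairwiseDisjoint-∘ : ∀ {k l} {f : Fin k → List (Fin n)} {σ : Fin l → Fin k} →
                       Injective _≡_ _≡_ σ → PairwiseDisjoint f → PairwiseDisjoint (f ∘ σ)
  PairwiseDisjoint-∘ σ-inj f-disjoint a b a≢b = f-disjoint _ _ (a≢b ∘ σ-inj)

  PairwiseDisjoint-++ : ∀ {k l} {f : Fin k → List (Fin n)} {g : Fin l → List (Fin n)} →
                        PairwiseDisjoint f → PairwiseDisjoint g → (∀ a b → Disjoint (f a) (g b)) →
                        PairwiseDisjoint (f ++ᵛ g)
  PairwiseDisjoint-++ {k} f-disjoint g-disjoint f∩g i j i≢j
    with splitAt k i in split-i | splitAt k j in split-j
  ... | inj₁ a | inj₁ b = f-disjoint a b λ { refl → i≢j (trans (sym (splitAt⁻¹-↑ˡ split-i)) (splitAt⁻¹-↑ˡ split-j)) }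
  ... | inj₁ a | inj₂ b = f∩g a b
  ... | inj₂ a | inj₁ b = Disjoint-sym (f∩g b a)
  ... | inj₂ a | inj₂ b = g-disjoint a b λ { refl → i≢j (trans (sym (splitAt⁻¹-↑ʳ split-i)) (splitAt⁻¹-↑ʳ split-j)) }

module _ {A : Set} {P : A → Set} where

  ++ᵛ-all : ∀ {k l} (f : Vector A k) (g : Vector A l) →
            (∀ a → P (f a)) → (∀ b → P (g b)) → ∀ i → P ((f ++ᵛ g) i)
  ++ᵛ-all {k} f g Pf Pg i with splitAt k i
  ... | inj₁ a = Pf a
  ... | inj₂ b = Pg b

module _ {n : ℕ} {G : Graph n} where

  IsPath-++⁻ʳ : ∀ (zs : List (Fin n)) {y ys} → IsPath G (zs ++ y ∷ ys) → IsPath G (y ∷ ys)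
  IsPath-++⁻ʳ zs p = record
    { nonempty = λ ()
    ; distinct = Unique-++⁻ʳ zs (IsPath.distinct p)
    ; adjacent = Linked-++⁻ʳ zs (IsPath.adjacent p) }

  IsPath-splice : ∀ (pre : List (Fin n)) {c suf qs qt} → IsPath G (pre ++ c ∷ suf) → IsPath G (qs ++ c ∷ qt) →
                  Disjoint pre (c ∷ qt) → IsPath G (pre ++ c ∷ qt)
  IsPath-splice pre {qs = qs} p q pre∩q = record
    { nonempty = λ eq → case ++-conicalʳ pre _ eq of λ ()
    ; distinct = Unique.++⁺ (Unique-++⁻ˡ pre (IsPath.distinct p)) (Unique-++⁻ʳ qs (IsPath.distinct q))
                            (λ (v∈pre , v∈q) → pre∩q _ v∈pre v∈q)
    ; adjacent = Linked-join pre (Linked-join⁻ˡ pre (IsPath.adjacent p)) (Linked-++⁻ʳ qs (IsPath.adjacent q)) }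

module _ {n : ℕ} {G : Graph n} {Y Z : Subset n} {p : List (Fin n)} (P : IsPathBetween G Y Z p) where

  start : Fin n
  start = proj₁ (IsPathBetween.first P)

  start-∈Y : start ∈ₛ Y
  start-∈Y = proj₁ (proj₂ (proj₂ (proj₂ (IsPathBetween.first P))))

  start-∈-rejoin : ∀ (xs : List (Fin n)) {c ys zs} → p ≡ xs ++ c ∷ ys → start ∈ xs ++ c ∷ zs
  start-∈-rejoin xs p≡ = ∈-rejoin xs (trans (sym p≡) (proj₁ (proj₂ (proj₂ (IsPathBetween.first P)))))

  end : Fin n
  end = proj₁ (proj₂ (IsPathBetween.last P))

  end-∈Z : end ∈ₛ Z
  end-∈Z = proj₁ (proj₂ (proj₂ (proj₂ (IsPathBetween.last P))))

  end-unique : ∀ u → u ∈ p → u ∈ₛ Z → u ≡ end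
  end-unique = proj₂ (proj₂ (proj₂ (proj₂ (IsPathBetween.last P))))

  end-∈ : end ∈ p
  end-∈ = subst (end ∈_) (sym (proj₁ (proj₂ (proj₂ (IsPathBetween.last P)))))
                (∈-++⁺ʳ (proj₁ (IsPathBetween.last P)) (here refl))

  end-suffix : ∀ (xs : List (Fin n)) {c ys} → p ≡ xs ++ c ∷ ys → ∃ λ ws → c ∷ ys ≡ ws ∷ʳ end
  end-suffix xs p≡ = ∷ʳ-suffix xs (trans (sym p≡) (proj₁ (proj₂ (proj₂ (IsPathBetween.last P)))))

  end-∈-suffix : ∀ (xs : List (Fin n)) {c ys} → p ≡ xs ++ c ∷ ys → end ∈ c ∷ ys
  end-∈-suffix xs p≡ with ws , eq ← end-suffix xs p≡ = subst (end ∈_) (sym eq) (∈-++⁺ʳ ws (here refl))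

module Rerouting {n : ℕ} (H : Graph n) (A B X : Subset n) {m : ℕ}
  (Q : Fin m → List (Fin n)) (Q-paths : ∀ k → IsPathBetween H A X (Q k)) (Q-disjoint : PairwiseDisjoint Q)
  {t : ℕ} (R : Fin t → List (Fin n)) where

  open import Data.List.Membership.DecPropositional (_≟_ {n}) using (_∈?_)

  Q-index-unique : ∀ {u j k} → u ∈ Q j → u ∈ Q k → j ≡ k
  Q-index-unique {u} {j} {k} u∈Qj u∈Qk with j ≟ k
  ... | yes j≡k = j≡k
  ... | no j≢k = ⊥-elim (Q-disjoint j k j≢k u u∈Qj u∈Qk)

  Q-inUnion : ∀ k → SubgraphOfUnion (Q k) Q R
  Q-inUnion k = (λ v v∈Qk → inj₁ (k , v∈Qk)) , (λ u v uv → inj₁ (k , inj₁ uv))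

  QStep : Fin n → Fin n → Set
  QStep u v = ∃ λ k → Consecutive (Q k) u v

  QStep? : ∀ u v → Dec (QStep u v)
  QStep? u v = any? (λ k → Consecutive? _≟_ (Q k) u v)

  QStep-closed : ∀ {k u v} → QStep u v → u ∈ Q k → v ∈ Q k
  QStep-closed {k} (j , uv) u∈Qk with u∈Qj , v∈Qj ← Consecutive⇒∈ uv =
    subst (λ k → _ ∈ Q k) (Q-index-unique u∈Qj u∈Qk) v∈Qj

  offQ : List (Fin n) → ℕ
  offQ = defects QStep?

  record Linkage (R′ : Fin t → List (Fin n)) : Set where
    field
      paths    : ∀ i → IsPathBetween H B X (R′ i)
      disjoint : PairwiseDisjoint R′
      inUnion  : ∀ i → SubgraphOfUnion (R′ i) Q R

  Φ : (Fin t → List (Fin n)) → ℕ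
  Φ R′ = sum (offQ ∘ R′)

  Used : (Fin t → List (Fin n)) → Fin n → Set
  Used R′ v = ∃ λ i → v ∈ R′ i

  Used? : ∀ R′ v → Dec (Used R′ v)
  Used? R′ v = any? (λ i → v ∈? R′ i)

  Settled : ∀ {R′} → Linkage R′ → Fin m → Set
  Settled {R′} L k = All (¬_ ∘ Used R′) (Q k) ⊎ ∃ λ i → end (Linkage.paths L i) ∈ Q k

  record Detour {R′} (L : Linkage R′) (k : Fin m) : Set where
    field
      i             : Fin t
      c             : Fin n
      qs qt pre suf : List (Fin n)
      Qₖ≡           : Q k ≡ qs ++ c ∷ qt
      Rᵢ≡           : R′ i ≡ pre ++ c ∷ suf
      qt-unused     : All (¬_ ∘ Used R′) qt
      c≢end         : c ≢ end (Linkage.paths L i)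

  classify : ∀ {R′} (L : Linkage R′) k → Settled L k ⊎ Detour L k
  classify {R′} L k with Any.any? (Used? R′) (Q k)
  ... | no unused = inj₁ (inj₁ (All.¬Any⇒All¬ (Q k) unused))
  ... | yes used with lastOccurrence (Used? R′) used
  ... | record { before = qs ; pivot = c ; after = qt ; split = Qₖ≡ ; pivot-P = i , c∈Rᵢ ; after-¬P = qt-unused }
    with c ≟ end (Linkage.paths L i) | ∈-∃++ c∈Rᵢ
  ... | yes refl | _ = inj₁ (inj₂ (i , subst (c ∈_) (sym Qₖ≡) (∈-++⁺ʳ qs (here refl))))
  ... | no c≢end | pre , suf , Rᵢ≡ = inj₂ record
    { i = i ; c = c ; qs = qs ; qt = qt ; pre = pre ; suf = suf
    ; Qₖ≡ = Qₖ≡ ; Rᵢ≡ = Rᵢ≡ ; qt-unused = qt-unused ; c≢end = c≢end }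

  module Reroute {R′ : Fin t → List (Fin n)} (L : Linkage R′) {k : Fin m} (d : Detour L k) where
    open Linkage L
    open Detour d

    e w : Fin n
    e = end (paths i)
    w = end (Q-paths k)

    pre∷c⊆Rᵢ : ∀ {u} → u ∈ pre ∷ʳ c → u ∈ R′ i
    pre∷c⊆Rᵢ {u} u∈ with ∈-++⁻ pre u∈
    ... | inj₁ u∈pre = subst (u ∈_) (sym Rᵢ≡) (∈-++⁺ˡ u∈pre)
    ... | inj₂ (here refl) = subst (u ∈_) (sym Rᵢ≡) (∈-++⁺ʳ pre (here refl))

    c∷qt⊆Qₖ : ∀ {u} → u ∈ c ∷ qt → u ∈ Q k
    c∷qt⊆Qₖ {u} u∈ = subst (u ∈_) (sym Qₖ≡) (∈-++⁺ʳ qs u∈)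

    c∷qt-step : ∀ {u v} → Consecutive (c ∷ qt) u v → Consecutive (Q k) u v
    c∷qt-step {u} {v} uv = subst (λ p → Consecutive p u v) (sym Qₖ≡) (Consecutive-++⁺ʳ qs uv)

    Rᵢ-unique : Unique (pre ++ c ∷ suf)
    Rᵢ-unique = subst Unique Rᵢ≡ (IsPath.distinct (IsPathBetween.isPath (paths i)))

    e∉pre : e ∉ pre
    e∉pre e∈pre = Unique-++⇒disjoint pre Rᵢ-unique e e∈pre (end-∈-suffix (paths i) pre Rᵢ≡)

    spliced : List (Fin n)
    spliced = pre ++ c ∷ qt

    spliced-vertex : ∀ {u} → u ∈ spliced → u ∈ R′ i ⊎ u ∈ qt
    spliced-vertex u∈ with ∈-++⁻ pre u∈
    ... | inj₁ u∈pre = inj₁ (pre∷c⊆Rᵢ (∈-++⁺ˡ u∈pre))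
    ... | inj₂ (here refl) = inj₁ (pre∷c⊆Rᵢ (∈-++⁺ʳ pre (here refl)))
    ... | inj₂ (there u∈qt) = inj₂ u∈qt

    spliced-step : ∀ {u v} → Consecutive spliced u v → Consecutive (R′ i) u v ⊎ Consecutive (Q k) u v
    spliced-step {u} {v} uv with Consecutive-join⁻ pre uv
    ... | inj₁ uv∈pre∷c = inj₁ (subst (λ p → Consecutive p u v) (sym Rᵢ≡) (Consecutive-join⁺ˡ pre uv∈pre∷c))
    ... | inj₂ uv∈c∷qt = inj₂ (c∷qt-step uv∈c∷qt)

    spliced-isPath : IsPath H spliced
    spliced-isPath = IsPath-splice pre
      (subst (IsPath H) Rᵢ≡ (IsPathBetween.isPath (paths i)))
      (subst (IsPath H) Qₖ≡ (IsPathBetween.isPath (Q-paths k)))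
      pre∩c∷qt
      where
      pre∩c∷qt : Disjoint pre (c ∷ qt)
      pre∩c∷qt u u∈pre (here refl) = Unique-++⇒disjoint pre Rᵢ-unique u u∈pre (here refl)
      pre∩c∷qt u u∈pre (there u∈qt) = All.lookup qt-unused u∈qt (i , pre∷c⊆Rᵢ (∈-++⁺ˡ u∈pre))

    spliced-ends-in-w : ∃ λ ws → spliced ≡ ws ∷ʳ w
    spliced-ends-in-w with ws , c∷qt≡ ← end-suffix (Q-paths k) qs Qₖ≡ =
      pre ++ ws , trans (cong (pre ++_) c∷qt≡) (sym (++-assoc pre ws [ w ]))

    spliced-X-unique : ∀ u → u ∈ spliced → u ∈ₛ X → u ≡ w
    spliced-X-unique u u∈ u∈X with ∈-++⁻ pre u∈
    ... | inj₁ u∈pre = ⊥-elim (e∉pre (subst (_∈ pre) u≡e u∈pre))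
      where
      u≡e : u ≡ e
      u≡e = end-unique (paths i) u (pre∷c⊆Rᵢ (∈-++⁺ˡ u∈pre)) u∈X
    ... | inj₂ u∈c∷qt = end-unique (Q-paths k) u (c∷qt⊆Qₖ u∈c∷qt) u∈X

    spliced-meets-B : Any (_∈ₛ B) spliced
    spliced-meets-B = lose (start-∈-rejoin (paths i) pre Rᵢ≡) (start-∈Y (paths i))

    open LastOccurrence (lastOccurrence (_∈ₛ? B) spliced-meets-B)

    new : List (Fin n)
    new = pivot ∷ after

    new⊆spliced : ∀ {u} → u ∈ new → u ∈ spliced
    new⊆spliced u∈ = subst (_ ∈_) (sym split) (∈-++⁺ʳ before u∈)

    new-step : ∀ {u v} → Consecutive new u v → Consecutive spliced u v
    new-step {u} {v} uv = subst (λ p → Consecutive p u v) (sym split) (Consecutive-++⁺ʳ before uv)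

    new-isPathBetween : IsPathBetween H B X new
    new-isPathBetween = record
      { isPath = IsPath-++⁻ʳ before (subst (IsPath H) split spliced-isPath)
      ; first  = pivot , after , refl , pivot-P , B-unique
      ; last   = proj₁ new-ends-in-w , w , proj₂ new-ends-in-w , end-∈Z (Q-paths k) ,
                 λ u u∈ → spliced-X-unique u (new⊆spliced u∈) }
      where
      B-unique : ∀ u → u ∈ new → u ∈ₛ B → u ≡ pivot
      B-unique u (here refl) _ = refl
      B-unique u (there u∈after) u∈B = ⊥-elim (All.lookup after-¬P u∈after u∈B)
      new-ends-in-w : ∃ λ ws → new ≡ ws ∷ʳ w
      new-ends-in-w = ∷ʳ-suffix before (trans (sym split) (proj₂ spliced-ends-in-w))

    new-inUnion : SubgraphOfUnion new Q R
    new-inUnion = vertices , edges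
      where
      vertices : ∀ u → u ∈ new → (∃ λ j → u ∈ Q j) ⊎ (∃ λ j → u ∈ R j)
      vertices u u∈ with spliced-vertex (new⊆spliced u∈)
      ... | inj₁ u∈Rᵢ = proj₁ (inUnion i) u u∈Rᵢ
      ... | inj₂ u∈qt = inj₁ (k , c∷qt⊆Qₖ (there u∈qt))
      edges : ∀ u v → EdgeOf new u v → (∃ λ j → HasEdge (Q j) u v) ⊎ (∃ λ j → HasEdge (R j) u v)
      edges u v uv
        with spliced-step (new-step (split⇒Consecutive uv))
      ... | inj₁ uv∈Rᵢ = proj₂ (inUnion i) u v (Consecutive⇒split uv∈Rᵢ)
      ... | inj₂ uv∈Qₖ = inj₁ (k , inj₁ (Consecutive⇒split uv∈Qₖ))

    new-disjoint : ∀ j → j ≢ i → Disjoint new (R′ j)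
    new-disjoint j j≢i u u∈ u∈Rⱼ with spliced-vertex (new⊆spliced u∈)
    ... | inj₁ u∈Rᵢ = disjoint i j (j≢i ∘ sym) u u∈Rᵢ u∈Rⱼ
    ... | inj₂ u∈qt = All.lookup qt-unused u∈qt (j , u∈Rⱼ)

    offQ-c∷qt : offQ (c ∷ qt) ≡ 0
    offQ-c∷qt = Linked⇒defects≡0 QStep?
      (Consecutive⇒Linked (c ∷ qt) λ uv → k , c∷qt-step uv)

    -- If every step of R′ i after c were a Q-step, R′ i would stay on Qₖ after c, so e = w ∈ c ∷ qt.
    offQ-c∷suf-pos : 0 < offQ (c ∷ suf)
    offQ-c∷suf-pos = n≢0⇒n>0 λ offQ≡0 → w-placement (end-∈-suffix (Q-paths k) qs Qₖ≡) (e≡w offQ≡0)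
      where
      e≡w : offQ (c ∷ suf) ≡ 0 → e ≡ w
      e≡w offQ≡0 = end-unique (Q-paths k) e (All.lookup c∷suf⊆Qₖ (end-∈-suffix (paths i) pre Rᵢ≡)) (end-∈Z (paths i))
        where
        c∷suf⊆Qₖ : All (_∈ Q k) (c ∷ suf)
        c∷suf⊆Qₖ = Linked-propagate QStep-closed (c∷qt⊆Qₖ (here refl)) (defects≡0⇒Linked QStep? (c ∷ suf) offQ≡0)
      w-placement : w ∈ c ∷ qt → e ≢ w
      w-placement (here w≡c) e≡w = c≢end (sym (trans e≡w w≡c))
      w-placement (there w∈qt) e≡w =
        All.lookup qt-unused w∈qt (i , subst (_∈ R′ i) e≡w (end-∈ (paths i)))

    new-offQ< : offQ new < offQ (R′ i)
    new-offQ< = begin-strict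
      offQ new                          ≤⟨ defects-++-≤ QStep? before ⟩
      offQ (before ++ new)              ≡⟨ cong offQ split ⟨
      offQ (pre ++ c ∷ qt)              ≡⟨ defects-join QStep? pre ⟩
      offQ (pre ∷ʳ c) + offQ (c ∷ qt)   ≡⟨ cong (offQ (pre ∷ʳ c) +_) offQ-c∷qt ⟩
      offQ (pre ∷ʳ c) + 0               <⟨ +-monoʳ-< (offQ (pre ∷ʳ c)) offQ-c∷suf-pos ⟩
      offQ (pre ∷ʳ c) + offQ (c ∷ suf)  ≡⟨ defects-join QStep? pre ⟨
      offQ (pre ++ c ∷ suf)             ≡⟨ cong offQ Rᵢ≡ ⟨
      offQ (R′ i)                       ∎
      where open ≤-Reasoning

    rerouted : Fin t → List (Fin n)
    rerouted j with j ≟ i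
    ... | yes _ = new
    ... | no _ = R′ j

    rerouted-linkage : Linkage rerouted
    rerouted-linkage = record { paths = paths′ ; disjoint = disjoint′ ; inUnion = inUnion′ }
      where
      paths′ : ∀ j → IsPathBetween H B X (rerouted j)
      paths′ j with j ≟ i
      ... | yes _ = new-isPathBetween
      ... | no _ = paths j
      inUnion′ : ∀ j → SubgraphOfUnion (rerouted j) Q R
      inUnion′ j with j ≟ i
      ... | yes _ = new-inUnion
      ... | no _ = inUnion j
      disjoint′ : PairwiseDisjoint rerouted
      disjoint′ j₁ j₂ j₁≢j₂ with j₁ ≟ i | j₂ ≟ i
      ... | yes refl | yes refl = ⊥-elim (j₁≢j₂ refl)
      ... | yes refl | no j₂≢i = new-disjoint j₂ j₂≢i
      ... | no j₁≢i | yes refl = Disjoint-sym (new-disjoint j₁ j₁≢i)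
      ... | no _ | no _ = disjoint j₁ j₂ j₁≢j₂

    Φ-rerouted< : Φ rerouted < Φ R′
    Φ-rerouted< = sum-<-at (offQ ∘ rerouted) (offQ ∘ R′) i unchanged decreased
      where
      unchanged : ∀ j → j ≢ i → offQ (rerouted j) ≡ offQ (R′ j)
      unchanged j j≢i with j ≟ i
      ... | yes j≡i = ⊥-elim (j≢i j≡i)
      ... | no _ = refl
      decreased : offQ (rerouted i) < offQ (R′ i)
      decreased with i ≟ i
      ... | yes _ = new-offQ<
      ... | no i≢i = ⊥-elim (i≢i refl)

  settle : ∀ {R′} (L : Linkage R′) → Acc _<_ (Φ R′) →
           Σ (Fin t → List (Fin n)) λ R* → Σ (Linkage R*) λ L* → ∀ k → Settled L* k
  settle {R′} L (acc smaller) with all⊎any (classify L)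
  ... | inj₁ settled = R′ , L , settled
  ... | inj₂ (k , d) = settle (Reroute.rerouted-linkage L d) (smaller (Reroute.Φ-rerouted< L d))

  -- Each end of R* lies on at most one Qₖ, so at most t of the Qₖ contain an end.
  settled-unused : ∀ {R*} (L* : Linkage R*) → (∀ k → Settled L* k) → ∀ {u} → u + t ≤ m →
                   Σ (Fin u → Fin m) λ σ → Injective _≡_ _≡_ σ × ∀ a b → Disjoint (Q (σ a)) (R* b)
  settled-unused {R*} L* settled u+t≤m
    with σ , σ-inj , unblocked ←
      unblocked-injection (λ i k → end (Linkage.paths L* i) ∈ Q k) (λ i k → _ ∈? Q k) Q-index-unique u+t≤m
    = σ , σ-inj , λ a b v v∈Q v∈R* → All.lookup (unused a) v∈Q (b , v∈R*)
    where
    unused : ∀ a → All (¬_ ∘ Used R*) (Q (σ a))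
    unused a = [ id , (λ (i , e∈Q) → ⊥-elim (unblocked a i e∈Q)) ]′ (settled (σ a))

  initialLinkage : (∀ i → IsPathBetween H B X (R i)) → PairwiseDisjoint R → Linkage R
  initialLinkage R-paths R-disjoint = record
    { paths = R-paths ; disjoint = R-disjoint
    ; inUnion = λ i → (λ v v∈ → inj₂ (i , v∈)) , (λ u v uv → inj₂ (i , inj₁ uv)) }

  avoidingLinkage : (∀ i → IsPathBetween H B X (R i)) → PairwiseDisjoint R → ∀ {u} → u + t ≤ m →
    Σ (Fin t → List (Fin n)) λ R* → Linkage R* ×
      Σ (Fin u → Fin m) λ σ → Injective _≡_ _≡_ σ × ∀ a b → Disjoint (Q (σ a)) (R* b)
  avoidingLinkage R-paths R-disjoint u+t≤m
    with R* , L* , settled ← settle (initialLinkage R-paths R-disjoint) (<-wellFounded (Φ R)) =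
    R* , L* , settled-unused L* settled u+t≤m

lemma15 : (t : ℕ) → t ≥ 1 → {n : ℕ} → (H : Graph n) → (A B X : Subset n)
    → (Q : Fin (2 * t) → List (Fin n)) → (R : Fin t → List (Fin n))
    → (∀ j → IsPathBetween H A X (Q j)) → PairwiseDisjoint Q
    → (∀ j → IsPathBetween H B X (R j)) → PairwiseDisjoint R
    → Σ (Fin (2 * t) → List (Fin n)) λ P →
        PairwiseDisjoint P
        × (∀ i → toℕ i < t → IsPathBetween H A X (P i))
        × (∀ i → toℕ i ≥ t → IsPathBetween H B X (P i))
        × (∀ i → toℕ i < t → ∃ λ j → P i ≡ Q j)
        × (∀ i → SubgraphOfUnion (P i) Q R)
lemma15 t _ {n} H A B X Q R Q-paths Q-disjoint R-paths R-disjoint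
  with R* , L* , σ , σ-inj , Q∩R* ← Rerouting.avoidingLinkage H A B X Q Q-paths Q-disjoint R R-paths R-disjoint
                                       (≤-reflexive (cong (t +_) (sym (+-identityʳ t))))
  = Qσ ++ᵛ R*′ ,
  PairwiseDisjoint-++ (PairwiseDisjoint-∘ σ-inj Q-disjoint) (PairwiseDisjoint-∘ (cast-injective _) disjoint)
                      (λ a b → Q∩R* a _) ,
  (λ i i<t → subst (IsPathBetween H A X) (sym (lookup-++-< Qσ R*′ i i<t)) (Q-paths _)) ,
  (λ i i≥t → subst (IsPathBetween H B X) (sym (lookup-++-≥ Qσ R*′ i i≥t)) (paths _)) ,
  (λ i i<t → _ , lookup-++-< Qσ R*′ i i<t) ,
  ++ᵛ-all {P = λ p → SubgraphOfUnion p Q R} Qσ R*′ (Q-inUnion ∘ σ) (inUnion ∘ cast _)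
  where
  open Rerouting H A B X Q Q-paths Q-disjoint R
  open Linkage L*
  Qσ : Fin t → List (Fin n)
  Qσ = Q ∘ σ
  -- Fin (2 * t) is Fin (t + (t + 0)) by definition.
  R*′ : Fin (t + 0) → List (Fin n)
  R*′ = R* ∘ cast (+-identityʳ t)
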